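{- For any positive integer $k$, there is a homomorphism of signed graphs $SPC^{\circ}(k+1)\to SPC^{\circ}(k)$.
   Context: A signed graph is a graph (loops allowed; at most one edge of each sign between two vertices, at most one loop of each sign at a vertex) with a sign $+$ or $-$ on each edge. Switching at a vertex set $X$ multiplies the signs of the edges with exactly one end in $X$ by $-1$. A homomorphism $(G,\sigma)\to(H,\pi)$ is a mapping of vertices to vertices and edges to edges preserving adjacencies, incidences and the signs of closed walks; equivalently, a signature $\sigma'$ obtained from $\sigma$ by switching and a mapping preserving adjacencies, incidences and edge signs with respect to $\sigma'$ and $\pi$. For $k\ge1$, $SPC^{\circ}(k)$ is the signed Cayley graph on $\mathbb{Z}_2^k$ in which $x,y$ are joined by a positive edge iff $x-y\in\{0,e_1,\dots,e_k\}$ (so every vertex carries a positive loop; $e_i$ the standard basis) and by a negative edge iff $x-y=J$, the all-ones vector. -}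

module Defs where

open import Data.Nat using (ℕ)
open import Data.Bool using (Bool; true; false; _xor_)
open import Data.Fin using (Fin)
open import Data.Vec using (Vec; []; _∷_; zipWith; replicate; _[_]≔_)
open import Data.Product using (Σ; ∃; _×_; _,_)
open import Data.Sum using (_⊎_; inj₁; inj₂)
open import Relation.Binary.PropositionalEquality using (_≡_; refl; trans; cong₂)

data Sign : Set where
  pos neg : Sign

flip : Sign → Sign
flip pos = neg
flip neg = pos

-- Edge u u s is a loop of sign s.
record SignedGraph : Set₁ where
  field
    Vertex : Set
    Edge   : Vertex → Vertex → Sign → Set
    sym    : ∀ {u v s} → Edge u v s → Edge v u s

open SignedGraph public

-- Sign of an edge uv after switching at the vertex set X (given by its
-- indicator function): flipped iff exactly one endpoint lies in X.
switchSign : {V : Set} → (V → Bool) → V → V → Sign → Sign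
switchSign X u v s with X u xor X v
... | true  = flip s
... | false = s

-- Homomorphism (G,σ) → (H,π): a switching σ' of σ (at a set X) together with
-- a vertex map f such that every edge uv of sign σ'(uv) is sent to an edge
-- f(u)f(v) of the same sign in H.  (Since there is at most one edge of each
-- sign between two vertices, the edge map is determined by f and the sign.)
Hom : SignedGraph → SignedGraph → Set
Hom G H =
  Σ (Vertex G → Bool) λ X →
  Σ (Vertex G → Vertex H) λ f →
    ∀ u v s → Edge G u v s → Edge H (f u) (f v) (switchSign X u v s)

-- Z_2^k as bit vectors, with addition = xor (so x - y = x xor y)
Z2^ : ℕ → Set
Z2^ k = Vec Bool k

_⊕_ : ∀ {k} → Z2^ k → Z2^ k → Z2^ k
_⊕_ = zipWith _xor_

zeroV : ∀ {k} → Z2^ k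
zeroV = replicate _ false

e : ∀ {k} → Fin k → Z2^ k
e i = zeroV [ i ]≔ true

J : ∀ {k} → Z2^ k
J = replicate _ true

SPCEdge : (k : ℕ) → Z2^ k → Z2^ k → Sign → Set
SPCEdge k x y pos = (x ⊕ y ≡ zeroV) ⊎ ∃ λ (i : Fin k) → x ⊕ y ≡ e i
SPCEdge k x y neg = x ⊕ y ≡ J

⊕-comm : ∀ {k} (x y : Z2^ k) → x ⊕ y ≡ y ⊕ x
⊕-comm [] [] = refl
⊕-comm (a ∷ x) (b ∷ y) = cong₂ _∷_ (xor-comm a b) (⊕-comm x y)
  where
  xor-comm : ∀ a b → a xor b ≡ b xor a
  xor-comm false false = refl
  xor-comm false true  = refl
  xor-comm true  false = refl
  xor-comm true  true  = refl

SPCEdge-sym : ∀ k {x y s} → SPCEdge k x y s → SPCEdge k y x s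
SPCEdge-sym k {x} {y} {pos} (inj₁ p) = inj₁ (trans (⊕-comm y x) p)
SPCEdge-sym k {x} {y} {pos} (inj₂ (i , p)) = inj₂ (i , trans (⊕-comm y x) p)
SPCEdge-sym k {x} {y} {neg} p = trans (⊕-comm y x) p

SPC° : ℕ → SignedGraph
SPC° k = record { Vertex = Z2^ k ; Edge = SPCEdge k ; sym = SPCEdge-sym k }

-- Write a vertex of SPC°(k+1) as a ∷ x with a ∈ Z₂ and x ∈ Z₂ᵏ.  The map
-- a ∷ x ↦ x + aJ is a group homomorphism Z₂ᵏ⁺¹ → Z₂ᵏ sending the positive
-- connection elements 0 and e₍ᵢ₊₁₎ to 0 and eᵢ, and exchanging the roles of e₀
-- and J (e₀ ↦ J, J ↦ 0).  So it maps edges to edges, except that edges whose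
-- difference has first coordinate 1 change sign; these are exactly the edges
-- switched by switching at the set of vertices with first coordinate 1.
module Submission where

open import Defs
open import Algebra.Bundles using (CommutativeRing)
open import Data.Bool using (Bool; true; false; _xor_)
open import Data.Bool.Properties using (xor-∧-commutativeRing)
open import Data.Fin using (Fin; zero; suc)
open import Data.Nat using (ℕ; suc; _≤_)
open import Data.Product using (∃; _,_)
open import Data.Sum using (_⊎_; inj₁; inj₂)
open import Data.Vec using ([]; _∷_; map; head)
open import Data.Vec.Properties using (map-id; map-replicate)
open import Relation.Binary.PropositionalEquality using (_≡_; refl; cong₂; subst₂)
open import Algebra.Properties.CommutativeSemigroup
  (CommutativeRing.+-commutativeSemigroup xor-∧-commutativeRing) using (interchange)

Connection : (k : ℕ) → Sign → Z2^ k → Set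
Connection k pos d = (d ≡ zeroV) ⊎ ∃ λ (i : Fin k) → d ≡ e i
Connection k neg d = d ≡ J

SPCEdge⇒Connection : ∀ {k x y} s → SPCEdge k x y s → Connection k s (x ⊕ y)
SPCEdge⇒Connection pos uv = uv
SPCEdge⇒Connection neg uv = uv

Connection⇒SPCEdge : ∀ {k x y} s → Connection k s (x ⊕ y) → SPCEdge k x y s
Connection⇒SPCEdge pos d = d
Connection⇒SPCEdge neg d = d

flipIf : Bool → Sign → Sign
flipIf true  s = flip s
flipIf false s = s

switchSign-head : ∀ {k} (u v : Z2^ (suc k)) s →
                  flipIf (head (u ⊕ v)) s ≡ switchSign head u v s
switchSign-head (a ∷ _) (b ∷ _) s with a xor b
... | true  = refl
... | false = refl

collapse : ∀ {k} → Z2^ (suc k) → Z2^ k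
collapse (a ∷ x) = map (a xor_) x

map-xor-⊕ : ∀ {k} a b (x y : Z2^ k) →
            map ((a xor b) xor_) (x ⊕ y) ≡ map (a xor_) x ⊕ map (b xor_) y
map-xor-⊕ a b []      []      = refl
map-xor-⊕ a b (c ∷ x) (d ∷ y) = cong₂ _∷_ (interchange a b c d) (map-xor-⊕ a b x y)

collapse-⊕ : ∀ {k} (u v : Z2^ (suc k)) → collapse (u ⊕ v) ≡ collapse u ⊕ collapse v
collapse-⊕ (a ∷ x) (b ∷ y) = map-xor-⊕ a b x y

collapse-Connection : ∀ {k} s (d : Z2^ (suc k)) →
                      Connection (suc k) s d → Connection k (flipIf (head d) s) (collapse d)
collapse-Connection {k} pos _ (inj₁ refl)           = inj₁ (map-replicate (false xor_) false k)
collapse-Connection {k} pos _ (inj₂ (zero , refl))  = map-replicate (true xor_) false k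
collapse-Connection     pos _ (inj₂ (suc i , refl)) = inj₂ (i , map-id (e i))
collapse-Connection {k} neg _ refl                  = inj₁ (map-replicate (true xor_) true k)

collapse-hom : ∀ k → Hom (SPC° (suc k)) (SPC° k)
collapse-hom k = head , collapse , λ u v s uv →
  Connection⇒SPCEdge (switchSign head u v s)
    (subst₂ (Connection k) (switchSign-head u v s) (collapse-⊕ u v)
      (collapse-Connection s (u ⊕ v) (SPCEdge⇒Connection s uv)))

mainTheorem6 : (k : ℕ) → 1 ≤ k → Hom (SPC° (suc k)) (SPC° k)
mainTheorem6 k _ = collapse-hom k
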